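{- Let $N,n$ be integers with $n\ge1$ and $N-2n+2\ge1$, and let $\lambda=(N,N-2,\dots,N-2n+2)$. Then \[ R^{(+1)}(\lambda)=\frac{|\lambda|}{N+1}\binom{N+1}{n}. \]
   Context: For a strict partition $\lambda$, its shifted Young diagram is $\{(i,j):1\le i\le\ell(\lambda),\ i\le j\le\lambda_i+i-1\}$. The shifted Young's lattice is the poset of strict partitions ordered by inclusion of shifted diagrams. $R^{(+1)}(\lambda)=\sum_{\mu}\mathrm{ddeg}(\mu)$, the sum over all strict partitions $\mu$ (including $\emptyset$) whose shifted diagram is contained in that of $\lambda$, where $\mathrm{ddeg}(\mu)$ is the number of elements covered by $\mu$ in the shifted Young's lattice. -}

module Defs where

open import Data.Nat using (ℕ; zero; suc; _+_; _*_; _∸_; _≤_; _<_)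
open import Data.List using (List; []; _∷_; map; upTo; length)
open import Data.Nat.ListAction using (sum)
open import Relation.Binary.PropositionalEquality using (_≡_)
open import Data.Empty using (⊥)
open import Data.Unit using (⊤)
open import Data.Product using (Σ; _×_)
open import Relation.Nullary using (¬_)
open import Function.Bundles using (_⇔_)
open import Data.List.Membership.Propositional using (_∈_)
open import Data.List.Relation.Unary.Unique.Propositional using (Unique)

data Strict : List ℕ → Set where
  nil  : Strict []
  one  : ∀ {a} → 1 ≤ a → Strict (a ∷ [])
  cons : ∀ {a b l} → b < a → Strict (b ∷ l) → Strict (a ∷ b ∷ l)

-- Shifted Young diagram, 0-indexed: cell (i , j) belongs to λ iff
-- i < ℓ(λ) and i ≤ j < λ_i + i  (0-indexed version of the paper's definition).
InDiag : List ℕ → ℕ → ℕ → Set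
InDiag []      _       _       = ⊥
InDiag (a ∷ l) zero    j       = j < a
InDiag (a ∷ l) (suc i) zero    = ⊥
InDiag (a ∷ l) (suc i) (suc j) = InDiag l i j

_⊆D_ : List ℕ → List ℕ → Set
μ ⊆D la = ∀ i j → InDiag μ i j → InDiag la i j

_⊂D_ : List ℕ → List ℕ → Set
μ ⊂D la = (μ ⊆D la) × ¬ (la ⊆D μ)

_⋖_ : List ℕ → List ℕ → Set
ν ⋖ μ = Strict ν × (ν ⊂D μ) × ¬ (Σ (List ℕ) λ ρ → Strict ρ × (ν ⊂D ρ) × (ρ ⊂D μ))

Enumerates : List (List ℕ) → (List ℕ → Set) → Set
Enumerates L P = Unique L × (∀ x → (x ∈ L) ⇔ P x)

DDeg : List ℕ → ℕ → Set
DDeg μ k = Σ (List (List ℕ)) λ L → Enumerates L (λ ν → ν ⋖ μ) × (length L ≡ k)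

SubStrict : List ℕ → List ℕ → Set
SubStrict la μ = Strict μ × (μ ⊆D la)

-- data computing R^{(+1)}(λ) = sum over L of d:
-- L enumerates all strict μ ⊆ λ (including ∅), and d μ = ddeg(μ) for each such μ
RData : List ℕ → List (List ℕ) → (List ℕ → ℕ) → Set
RData la L d = Enumerates L (SubStrict la) × (∀ μ → μ ∈ L → DDeg μ (d μ))

lam : ℕ → ℕ → List ℕ
lam N n = map (λ i → N ∸ 2 * i) (upTo n)

size : List ℕ → ℕ
size = sum

module Submission where

-- The elements covered by a strict μ are obtained by removing one corner of its shifted
-- diagram, so ddeg(μ) is the number of removable corners of μ.  A strict μ inside
-- λ = (N, N−2, …, N−2n+2) either has all parts ≥ 2, and is then (1 + ν) for a strict ν
-- inside (N−1, N−3, …), or ends in the part 1, and is then (1 + ν, 1) for a strict ν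
-- inside (N−1, …) with one part fewer.  This gives Pascal-type recursions: there are
-- C(N+1, n) such μ, with n C(N, n) removable corners in total.  Since |λ| = n(N + 1 − n)
-- and (N + 1 − n) C(N+1, n) = (N + 1) C(N, n), this is the claimed value.

open import Data.Bool using (Bool; true; false; if_then_else_; T)
open import Data.Empty using (⊥)
open import Data.List using (List; []; _∷_; _++_; _∷ʳ_; map; length; applyUpTo)
open import Data.List.Membership.Propositional using (_∈_)
open import Data.List.Membership.Propositional.Properties
  using (∈-map⁺; ∈-map⁻; ∈-++⁺ˡ; ∈-++⁺ʳ; ∈-++⁻)
open import Data.List.Membership.Propositional.Properties.WithK using (unique∧set⇒bag)
open import Data.List.Properties
  using (length-++; length-map; map-++; map-∘; map-cong; map-cong-local; map-upTo; applyUpTo-∷ʳ;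
         ∷-injectiveˡ; ∷-injectiveʳ; ≡-dec)
open import Data.List.Relation.Binary.BagAndSetEquality using (∼bag⇒↭)
open import Data.List.Relation.Binary.Permutation.Propositional using (_↭_)
open import Data.List.Relation.Binary.Permutation.Propositional.Properties using (↭-length)
import Data.List.Relation.Binary.Permutation.Propositional.Properties as ↭
open import Data.List.Relation.Unary.All as All using (All; []; _∷_)
open import Data.List.Relation.Unary.AllPairs using ([]; _∷_)
open import Data.List.Relation.Unary.Any using (here)
open import Data.List.Relation.Unary.Unique.Propositional using (Unique)
import Data.List.Relation.Unary.Unique.Propositional.Properties as Unique
open import Data.Nat using (ℕ; zero; suc; pred; _+_; _*_; _∸_; _≤_; _<_; z≤n; s≤s; _≤ᵇ_; _≟_; _≤?_)
open import Data.Nat.Combinatorics using (_C_; nCk+nC[k+1]≡[n+1]C[k+1]; nC1≡n; nCk≡nC[n∸k])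
open import Data.Nat.ListAction using (sum)
open import Data.Nat.ListAction.Properties using (sum-++; sum-↭)
open import Data.Nat.Properties
open import Data.Nat.Tactic.RingSolver using (solve-∀)
open import Data.Product using (Σ; ∃; _×_; _,_; proj₁; proj₂)
open import Data.Sum using (_⊎_; inj₁; inj₂)
open import Data.Unit using (⊤; tt)
open import Function.Bundles using (_⇔_; Equivalence; mk⇔)
open import Relation.Binary.PropositionalEquality
open import Relation.Nullary using (¬_; yes; no; contradiction)

open import Defs

[1+k]*[1+n]C[1+k]≡[1+n]*nCk : ∀ n k → suc k * (suc n C suc k) ≡ suc n * (n C k)
[1+k]*[1+n]C[1+k]≡[1+n]*nCk zero    zero    = refl
[1+k]*[1+n]C[1+k]≡[1+n]*nCk zero    (suc k) = *-zeroʳ (suc (suc k))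
[1+k]*[1+n]C[1+k]≡[1+n]*nCk (suc n) zero    =
  trans (+-identityʳ _) (trans (nC1≡n (suc (suc n))) (sym (*-identityʳ _)))
[1+k]*[1+n]C[1+k]≡[1+n]*nCk (suc n) (suc k) = begin
    suc (suc k) * (suc (suc n) C suc (suc k))
  ≡⟨ cong (suc (suc k) *_) (sym (nCk+nC[k+1]≡[n+1]C[k+1] (suc n) (suc k))) ⟩
    suc (suc k) * (suc n C suc k + suc n C suc (suc k))
  ≡⟨ split (suc k) (suc n C suc k) (suc n C suc (suc k)) ⟩
    suc k * (suc n C suc k) + suc n C suc k + suc (suc k) * (suc n C suc (suc k))
  ≡⟨ cong₂ (λ x y → x + suc n C suc k + y)
          ([1+k]*[1+n]C[1+k]≡[1+n]*nCk n k) ([1+k]*[1+n]C[1+k]≡[1+n]*nCk n (suc k)) ⟩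
    suc n * (n C k) + suc n C suc k + suc n * (n C suc k)
  ≡⟨ merge (suc n) (n C k) (n C suc k) (suc n C suc k) ⟩
    suc n * (n C k + n C suc k) + suc n C suc k
  ≡⟨ cong (λ x → suc n * x + suc n C suc k) (nCk+nC[k+1]≡[n+1]C[k+1] n k) ⟩
    suc n * (suc n C suc k) + suc n C suc k
  ≡⟨ +-comm (suc n * (suc n C suc k)) _ ⟩
    suc (suc n) * (suc n C suc k)
  ∎
  where
  open ≡-Reasoning
  split : ∀ a x y → suc a * (x + y) ≡ a * x + x + suc a * y
  split = solve-∀
  merge : ∀ a x y z → a * x + z + a * y ≡ a * (x + y) + z
  merge = solve-∀

C-middle : ∀ n → suc (n + n) C n ≡ suc (n + n) C suc n
C-middle n = begin
    suc (n + n) C n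
  ≡⟨ nCk≡nC[n∸k] {n} {suc (n + n)} (≤-trans (m≤m+n n n) (n≤1+n _)) ⟩
    suc (n + n) C (suc (n + n) ∸ n)
  ≡⟨ cong (λ k → suc (n + n) C k) (trans (+-∸-assoc 1 (m≤n+m n n)) (cong suc (m+n∸n≡m n n))) ⟩
    suc (n + n) C suc n
  ∎
  where open ≡-Reasoning

strict-head-pos : ∀ {a l} → Strict (a ∷ l) → 1 ≤ a
strict-head-pos (one 1≤a)    = 1≤a
strict-head-pos (cons b<a s) = ≤-trans (s≤s z≤n) b<a

strict-tail : ∀ {a l} → Strict (a ∷ l) → Strict l
strict-tail (one _)    = nil
strict-tail (cons _ s) = s

Positive : List ℕ → Set
Positive = All (1 ≤_)

strict⇒positive : ∀ {l} → Strict l → Positive l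
strict⇒positive nil          = []
strict⇒positive (one 1≤a)    = 1≤a ∷ []
strict⇒positive (cons b<a s) = strict-head-pos (cons b<a s) ∷ strict⇒positive s

infix 4 _⊑_

_⊑_ : List ℕ → List ℕ → Set
[]      ⊑ _       = ⊤
(a ∷ l) ⊑ []      = ⊥
(a ∷ l) ⊑ (b ∷ m) = a ≤ b × l ⊑ m

⊑-refl : ∀ l → l ⊑ l
⊑-refl []      = tt
⊑-refl (a ∷ l) = ≤-refl , ⊑-refl l

⊑-antisym : ∀ {l m} → l ⊑ m → m ⊑ l → l ≡ m
⊑-antisym {[]}    {[]}    _         _           = refl
⊑-antisym {a ∷ l} {b ∷ m} (a≤b , p) (b≤a , q) = cong₂ _∷_ (≤-antisym a≤b b≤a) (⊑-antisym p q)

⊑-[] : ∀ {l} → l ⊑ [] → l ≡ []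
⊑-[] {[]} _ = refl

⊑⇒⊆D : ∀ {l m} → l ⊑ m → l ⊆D m
⊑⇒⊆D {a ∷ l} {b ∷ m} (a≤b , _) zero    j       j<a = ≤-trans j<a a≤b
⊑⇒⊆D {a ∷ l} {b ∷ m} (_ , l⊑m) (suc i) (suc j) ij∈l = ⊑⇒⊆D l⊑m i j ij∈l

⊆D⇒⊑ : ∀ {l m} → Positive l → l ⊆D m → l ⊑ m
⊆D⇒⊑ {[]}        _            _   = tt
⊆D⇒⊑ {a ∷ l}     {[]} (pa ∷ _) l⊆m = l⊆m 0 0 pa
⊆D⇒⊑ {suc a ∷ l} {b ∷ m} (_ ∷ pl) l⊆m =
  l⊆m 0 a ≤-refl , ⊆D⇒⊑ pl (λ i j → l⊆m (suc i) (suc j))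

⊑∧≢⇒⊂D : ∀ {l m} → Positive m → l ⊑ m → l ≢ m → l ⊂D m
⊑∧≢⇒⊂D pm l⊑m l≢m = ⊑⇒⊆D l⊑m , λ m⊆l → l≢m (⊑-antisym l⊑m (⊆D⇒⊑ pm m⊆l))

⊂D⇒⊑∧≢ : ∀ {l m} → Positive l → l ⊂D m → l ⊑ m × l ≢ m
⊂D⇒⊑∧≢ pl (l⊆m , m⊈l) = ⊆D⇒⊑ pl l⊆m , λ { refl → m⊈l (λ _ _ h → h) }

-- μ lies inside (N − 2k, N − 2k − 2, …) and has at most n parts; the bound on part i is
-- written as μᵢ + 2(k + i) ≤ N to avoid truncated subtraction.
FitsStair : ℕ → ℕ → ℕ → List ℕ → Set
FitsStair k N n       []      = ⊤
FitsStair k N zero    (a ∷ l) = ⊥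
FitsStair k N (suc n) (a ∷ l) = a + 2 * k ≤ N × FitsStair (suc k) N n l

1≤a≤N∸m⇒a+m≤N : ∀ {a} m {N} → 1 ≤ a → a ≤ N ∸ m → a + m ≤ N
1≤a≤N∸m⇒a+m≤N {a} m 1≤a a≤N∸m =
  m≤o∸n⇒m+n≤o a (<⇒≤ (m∸n≢0⇒n<m λ N∸m≡0 → <⇒≱ 1≤a (subst (a ≤_) N∸m≡0 a≤N∸m))) a≤N∸m

module _ (N : ℕ) where

  stair : ℕ → ℕ → ℕ
  stair k i = N ∸ 2 * (k + i)

  stair-suc : ∀ k i → stair k (suc i) ≡ stair (suc k) i
  stair-suc k i = cong (λ j → N ∸ 2 * j) (+-suc k i)

  stair-0 : ∀ k → stair k 0 ≡ N ∸ 2 * k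
  stair-0 k = cong (λ j → N ∸ 2 * j) (+-identityʳ k)

  fitsStair⇒⊑ : ∀ k n (f : ℕ → ℕ) → (∀ i → f i ≡ stair k i) →
                ∀ μ → FitsStair k N n μ → μ ⊑ applyUpTo f n
  fitsStair⇒⊑ k n       f f≗ []      _         = tt
  fitsStair⇒⊑ k (suc n) f f≗ (a ∷ μ) (a≤ , μ≤) =
    subst (a ≤_) (sym (trans (f≗ 0) (stair-0 k))) (m+n≤o⇒m≤o∸n a a≤) ,
    fitsStair⇒⊑ (suc k) n (λ i → f (suc i)) (λ i → trans (f≗ (suc i)) (stair-suc k i)) μ μ≤

  ⊑⇒fitsStair : ∀ k n (f : ℕ → ℕ) → (∀ i → f i ≡ stair k i) →
                ∀ μ → Positive μ → μ ⊑ applyUpTo f n → FitsStair k N n μ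
  ⊑⇒fitsStair k n       f f≗ []      _          _         = tt
  ⊑⇒fitsStair k (suc n) f f≗ (a ∷ μ) (pa ∷ pμ) (a≤ , μ⊑) =
    1≤a≤N∸m⇒a+m≤N (2 * k) pa (subst (a ≤_) (trans (f≗ 0) (stair-0 k)) a≤) ,
    ⊑⇒fitsStair (suc k) n (λ i → f (suc i)) (λ i → trans (f≗ (suc i)) (stair-suc k i)) μ pμ μ⊑

  lam-stair : ∀ n → lam N n ≡ applyUpTo (stair 0) n
  lam-stair = map-upTo (λ i → N ∸ 2 * i)

  ⊆D-lam⇔fitsStair : ∀ {n μ} → Strict μ → (μ ⊆D lam N n) ⇔ FitsStair 0 N n μ
  ⊆D-lam⇔fitsStair {n} {μ} sμ = mk⇔
    (λ μ⊆λ → ⊑⇒fitsStair 0 n (stair 0) (λ _ → refl) μ (strict⇒positive sμ)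
               (subst (μ ⊑_) (lam-stair n) (⊆D⇒⊑ (strict⇒positive sμ) μ⊆λ)))
    (λ fits → ⊑⇒⊆D (subst (μ ⊑_) (sym (lam-stair n))
                         (fitsStair⇒⊑ 0 n (stair 0) (λ _ → refl) μ fits)))

grow : List ℕ → List ℕ
grow = map suc

grow∷ʳ1 : List ℕ → List ℕ
grow∷ʳ1 ν = grow ν ∷ʳ 1

-- When 2n > N the last row N + 1 − 2n of λ = lam (N + 1) (n + 1) is empty, so λ = lam (N + 1) n.
strictSubs : ℕ → ℕ → List (List ℕ)
strictSubs zero    n       = [] ∷ []
strictSubs (suc N) zero    = [] ∷ []
strictSubs (suc N) (suc n) with 2 * n ≤? N
... | yes _ = map grow (strictSubs N (suc n)) ++ map grow∷ʳ1 (strictSubs N n)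
... | no  _ = strictSubs (suc N) n

strictSubs-step : ∀ N n → 2 * n ≤ N →
  strictSubs (suc N) (suc n) ≡ map grow (strictSubs N (suc n)) ++ map grow∷ʳ1 (strictSubs N n)
strictSubs-step N n 2n≤N with 2 * n ≤? N
... | yes _   = refl
... | no 2n≰N = contradiction 2n≤N 2n≰N

strictSubs-collapse : ∀ N n → N ≤ 2 * n → strictSubs N (suc n) ≡ strictSubs N n
strictSubs-collapse zero    n _ = refl
strictSubs-collapse (suc N) n 1+N≤2n with 2 * n ≤? N
... | no  _    = refl
... | yes 2n≤N = contradiction (≤-trans 1+N≤2n 2n≤N) 1+n≰n

data GrowView (μ : List ℕ) : Set where
  grown    : ∀ ν → Strict ν → μ ≡ grow ν    → GrowView μ
  grown∷ʳ1 : ∀ ν → Strict ν → μ ≡ grow∷ʳ1 ν → GrowView μ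

growView : ∀ {μ} → Strict μ → GrowView μ
growView nil                  = grown [] nil refl
growView (one {suc zero} _)   = grown∷ʳ1 [] nil refl
growView (one {suc (suc a)} _) = grown (suc a ∷ []) (one (s≤s z≤n)) refl
growView (cons {suc a} b<a s) with growView s
... | grown    (c ∷ ν) sν refl = grown    (a ∷ c ∷ ν) (cons (≤-pred b<a) sν) refl
... | grown∷ʳ1 []      _  refl = grown∷ʳ1 (a ∷ [])    (one (≤-pred b<a)) refl
... | grown∷ʳ1 (c ∷ ν) sν refl = grown∷ʳ1 (a ∷ c ∷ ν) (cons (≤-pred b<a) sν) refl

strict-grow : ∀ {ν} → Strict ν → Strict (grow ν)
strict-grow nil          = nil
strict-grow (one _)      = one (s≤s z≤n)
strict-grow (cons b<a s) = cons (s≤s b<a) (strict-grow s)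

strict-grow∷ʳ1 : ∀ {ν} → Strict ν → Strict (grow∷ʳ1 ν)
strict-grow∷ʳ1 nil          = one (s≤s z≤n)
strict-grow∷ʳ1 (one 1≤a)    = cons (s≤s 1≤a) (one (s≤s z≤n))
strict-grow∷ʳ1 (cons b<a s) = cons (s≤s b<a) (strict-grow∷ʳ1 s)

fitsStair-grow : ∀ k N n ν → FitsStair k N n ν → FitsStair k (suc N) n (grow ν)
fitsStair-grow k N n       []      _         = tt
fitsStair-grow k N (suc n) (a ∷ ν) (a≤ , ν≤) = s≤s a≤ , fitsStair-grow (suc k) N n ν ν≤

fitsStair-grow⁻ : ∀ k N n ν → FitsStair k (suc N) n (grow ν) → FitsStair k N n ν
fitsStair-grow⁻ k N n       []      _         = tt
fitsStair-grow⁻ k N (suc n) (a ∷ ν) (a≤ , ν≤) = ≤-pred a≤ , fitsStair-grow⁻ (suc k) N n ν ν≤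

fitsStair-grow∷ʳ1 : ∀ k N n ν → FitsStair k N n ν → 2 * (k + n) ≤ N →
                    FitsStair k (suc N) (suc n) (grow∷ʳ1 ν)
fitsStair-grow∷ʳ1 k N n       []      _         2[k+n]≤N =
  s≤s (≤-trans (*-monoʳ-≤ 2 (m≤m+n k n)) 2[k+n]≤N) , tt
fitsStair-grow∷ʳ1 k N (suc n) (a ∷ ν) (a≤ , ν≤) 2[k+n]≤N =
  s≤s a≤ , fitsStair-grow∷ʳ1 (suc k) N n ν ν≤ (subst (λ j → 2 * j ≤ N) (+-suc k n) 2[k+n]≤N)

fitsStair-grow∷ʳ1⁻ : ∀ k N n ν → FitsStair k (suc N) (suc n) (grow∷ʳ1 ν) → FitsStair k N n ν
fitsStair-grow∷ʳ1⁻ k N n       []          _         = tt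
fitsStair-grow∷ʳ1⁻ k N zero    (a ∷ [])    (_ , ())
fitsStair-grow∷ʳ1⁻ k N zero    (a ∷ _ ∷ _) (_ , ())
fitsStair-grow∷ʳ1⁻ k N (suc n) (a ∷ ν)     (a≤ , ν≤) =
  ≤-pred a≤ , fitsStair-grow∷ʳ1⁻ (suc k) N n ν ν≤

fitsStair-suc : ∀ k N n μ → FitsStair k N n μ → FitsStair k N (suc n) μ
fitsStair-suc k N n       []      _         = tt
fitsStair-suc k N (suc n) (a ∷ μ) (a≤ , μ≤) = a≤ , fitsStair-suc (suc k) N n μ μ≤

-- A positive part in row k + n would need 1 + 2(k + n) ≤ N.
fitsStair-pred : ∀ k N n μ → N ≤ 2 * (k + n) → Positive μ → FitsStair k N (suc n) μ → FitsStair k N n μ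
fitsStair-pred k N n       []      _ _ _ = tt
fitsStair-pred k N zero    (a ∷ μ) N≤2k (1≤a ∷ _) (a≤ , _) =
  contradiction (≤-trans (+-monoˡ-≤ (2 * k) 1≤a) a≤)
                (<⇒≱ (s≤s (subst (λ j → N ≤ 2 * j) (+-identityʳ k) N≤2k)))
fitsStair-pred k N (suc n) (a ∷ μ) N≤2[k+1+n] (_ ∷ pμ) (a≤ , μ≤) =
  a≤ , fitsStair-pred (suc k) N n μ (subst (λ j → N ≤ 2 * j) (+-suc k n) N≤2[k+1+n]) pμ μ≤

strictSubs-sound : ∀ N n μ → μ ∈ strictSubs N n → Strict μ × FitsStair 0 N n μ
strictSubs-sound zero    n       .[] (here refl) = nil , tt
strictSubs-sound (suc N) zero    .[] (here refl) = nil , tt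
strictSubs-sound (suc N) (suc n) μ   μ∈ with 2 * n ≤? N
... | no 2n≰N =
  let sμ , fits = strictSubs-sound (suc N) n μ μ∈ in sμ , fitsStair-suc 0 (suc N) n μ fits
... | yes 2n≤N with ∈-++⁻ (map grow (strictSubs N (suc n))) μ∈
...   | inj₁ μ∈grow with ∈-map⁻ grow μ∈grow
...     | ν , ν∈ , refl =
  let sν , fits = strictSubs-sound N (suc n) ν ν∈ in strict-grow sν , fitsStair-grow 0 N (suc n) ν fits
strictSubs-sound (suc N) (suc n) μ μ∈ | yes 2n≤N | inj₂ μ∈grow∷ʳ1 with ∈-map⁻ grow∷ʳ1 μ∈grow∷ʳ1
...     | ν , ν∈ , refl =
  let sν , fits = strictSubs-sound N n ν ν∈ in strict-grow∷ʳ1 sν , fitsStair-grow∷ʳ1 0 N n ν fits 2n≤N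

strictSubs-complete : ∀ N n μ → Strict μ → FitsStair 0 N n μ → μ ∈ strictSubs N n
strictSubs-complete zero    n       []      _  _        = here refl
strictSubs-complete zero    (suc n) (a ∷ μ) sμ (a≤0 , _) =
  contradiction (subst (_≤ 0) (+-identityʳ a) a≤0) (<⇒≱ (strict-head-pos sμ))
strictSubs-complete (suc N) zero    []      _  _        = here refl
strictSubs-complete (suc N) (suc n) μ       sμ fits with 2 * n ≤? N
... | no 2n≰N =
  strictSubs-complete (suc N) n μ sμ
    (fitsStair-pred 0 (suc N) n μ (≰⇒> 2n≰N) (strict⇒positive sμ) fits)
... | yes 2n≤N with growView sμ
...   | grown ν sν refl =
  ∈-++⁺ˡ (∈-map⁺ grow (strictSubs-complete N (suc n) ν sν (fitsStair-grow⁻ 0 N (suc n) ν fits)))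
...   | grown∷ʳ1 ν sν refl =
  ∈-++⁺ʳ (map grow (strictSubs N (suc n)))
    (∈-map⁺ grow∷ʳ1 (strictSubs-complete N n ν sν (fitsStair-grow∷ʳ1⁻ 0 N n ν fits)))

grow-injective : ∀ {ν ν′} → grow ν ≡ grow ν′ → ν ≡ ν′
grow-injective {[]}    {[]}     _  = refl
grow-injective {a ∷ ν} {b ∷ ν′} eq =
  cong₂ _∷_ (suc-injective (∷-injectiveˡ eq)) (grow-injective (∷-injectiveʳ eq))

grow∷ʳ1-injective : ∀ {ν ν′} → grow∷ʳ1 ν ≡ grow∷ʳ1 ν′ → ν ≡ ν′
grow∷ʳ1-injective {[]}        {[]}         _  = refl
grow∷ʳ1-injective {[]}        {_ ∷ []}     ()
grow∷ʳ1-injective {[]}        {_ ∷ _ ∷ _}  ()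
grow∷ʳ1-injective {_ ∷ []}    {[]}         ()
grow∷ʳ1-injective {_ ∷ _ ∷ _} {[]}         ()
grow∷ʳ1-injective {a ∷ ν}     {b ∷ ν′}     eq =
  cong₂ _∷_ (suc-injective (∷-injectiveˡ eq)) (grow∷ʳ1-injective (∷-injectiveʳ eq))

grow≢grow∷ʳ1 : ∀ ν ν′ → Positive ν → grow ν ≢ grow∷ʳ1 ν′
grow≢grow∷ʳ1 []          []           _          ()
grow≢grow∷ʳ1 []          (_ ∷ _)      _          ()
grow≢grow∷ʳ1 (a ∷ [])    []           (1≤a ∷ _) refl = <⇒≱ 1≤a ≤-refl
grow≢grow∷ʳ1 (a ∷ [])    (_ ∷ [])     _          ()
grow≢grow∷ʳ1 (a ∷ [])    (_ ∷ _ ∷ _)  _          ()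
grow≢grow∷ʳ1 (_ ∷ _ ∷ _) []           _          ()
grow≢grow∷ʳ1 (a ∷ b ∷ ν) (_ ∷ ν′)     (_ ∷ pν)   eq =
  grow≢grow∷ʳ1 (b ∷ ν) ν′ pν (∷-injectiveʳ eq)

strictSubs-unique : ∀ N n → Unique (strictSubs N n)
strictSubs-unique zero    n       = [] ∷ []
strictSubs-unique (suc N) zero    = [] ∷ []
strictSubs-unique (suc N) (suc n) with 2 * n ≤? N
... | no  _ = strictSubs-unique (suc N) n
... | yes _ = Unique.++⁺ (Unique.map⁺ grow-injective (strictSubs-unique N (suc n)))
                         (Unique.map⁺ grow∷ʳ1-injective (strictSubs-unique N n))
                         disjoint
  where
  disjoint : ∀ {μ} → ¬ (μ ∈ map grow (strictSubs N (suc n)) × μ ∈ map grow∷ʳ1 (strictSubs N n))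
  disjoint (μ∈grow , μ∈grow∷ʳ1) with ∈-map⁻ grow μ∈grow | ∈-map⁻ grow∷ʳ1 μ∈grow∷ʳ1
  ... | ν , ν∈ , refl | ν′ , _ , eq =
    grow≢grow∷ʳ1 ν ν′ (strict⇒positive (proj₁ (strictSubs-sound N (suc n) ν ν∈))) eq

strictSubs-enumerates : ∀ N n → Enumerates (strictSubs N n) (SubStrict (lam N n))
strictSubs-enumerates N n = strictSubs-unique N n , λ μ → mk⇔
  (λ μ∈ → let sμ , fits = strictSubs-sound N n μ μ∈ in
          sμ , Equivalence.from (⊆D-lam⇔fitsStair N sμ) fits)
  (λ (sμ , μ⊆λ) → strictSubs-complete N n μ sμ (Equivalence.to (⊆D-lam⇔fitsStair N sμ) μ⊆λ))

-- The corner of a row can be removed iff its part exceeds the next one by at least 2;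
-- the corner of the last row always can, and a last part 1 then disappears.
hasGap : ℕ → ℕ → Bool
hasGap a b = 2 + b ≤ᵇ a

headCover : ℕ → ℕ → List ℕ → List (List ℕ)
headCover a b l = if hasGap a b then (pred a ∷ b ∷ l) ∷ [] else []

shrinkLast : ℕ → List ℕ
shrinkLast a = if 2 ≤ᵇ a then pred a ∷ [] else []

lowerCovers : List ℕ → List (List ℕ)
lowerCovers []          = []
lowerCovers (a ∷ [])    = shrinkLast a ∷ []
lowerCovers (a ∷ b ∷ l) = headCover a b l ++ map (a ∷_) (lowerCovers (b ∷ l))

∈-headCover⁻ : ∀ {a b l ν} → ν ∈ headCover a b l → 2 + b ≤ a × ν ≡ pred a ∷ b ∷ l
∈-headCover⁻ {a} {b} {l} ν∈ with hasGap a b in gap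
∈-headCover⁻ {a} {b} ν∈ | true with here refl ← ν∈ = ≤ᵇ⇒≤ (2 + b) a (subst T (sym gap) tt) , refl

∈-headCover⁺ : ∀ {a b} l → 2 + b ≤ a → pred a ∷ b ∷ l ∈ headCover a b l
∈-headCover⁺ {a} {b} l 2+b≤a with hasGap a b | ≤⇒≤ᵇ 2+b≤a
... | true | _ = here refl

∈-lowerCovers-cons⁺ : ∀ {a b l ν} → ν ∈ lowerCovers (b ∷ l) → a ∷ ν ∈ lowerCovers (a ∷ b ∷ l)
∈-lowerCovers-cons⁺ {a} {b} {l} ν∈ = ∈-++⁺ʳ (headCover a b l) (∈-map⁺ (a ∷_) ν∈)

cons-strict : ∀ {a b ν l} → Strict ν → ν ⊑ b ∷ l → b < a → Strict (a ∷ ν)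
cons-strict {ν = []}    _  _         b<a = one (≤-trans (s≤s z≤n) b<a)
cons-strict {ν = c ∷ ν} sν (c≤b , _) b<a = cons (≤-<-trans c≤b b<a) sν

lowerCovers-below : ∀ {μ ν} → Strict μ → ν ∈ lowerCovers μ → Strict ν × ν ⊑ μ × ν ≢ μ
lowerCovers-below {suc zero ∷ []} _ (here refl) = nil , tt , λ ()
lowerCovers-below {suc (suc a) ∷ []} _ (here refl) =
  one (s≤s z≤n) , (n≤1+n _ , tt) , λ eq → 1+n≢n (sym (∷-injectiveˡ eq))
lowerCovers-below {a ∷ b ∷ l} (cons b<a sμ) ν∈ with ∈-++⁻ (headCover a b l) ν∈
... | inj₁ ν∈head with ∈-headCover⁻ {a} ν∈head
...   | 2+b≤a , refl with a
...     | suc a′ =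
  cons (≤-pred 2+b≤a) sμ , (n≤1+n a′ , ⊑-refl (b ∷ l)) , λ eq → 1+n≢n (sym (∷-injectiveˡ eq))
lowerCovers-below {a ∷ b ∷ l} (cons b<a sμ) ν∈ | inj₂ ν∈tail with ∈-map⁻ (a ∷_) ν∈tail
... | ν′ , ν′∈ , refl with lowerCovers-below sμ ν′∈
...   | sν′ , ν′⊑ , ν′≢ =
  cons-strict sν′ ν′⊑ b<a , (≤-refl , ν′⊑) , λ eq → ν′≢ (∷-injectiveʳ eq)

a≤c≤1+a⇒c≡a⊎c≡1+a : ∀ {a c} → a ≤ c → c ≤ suc a → c ≡ a ⊎ c ≡ suc a
a≤c≤1+a⇒c≡a⊎c≡1+a a≤c c≤1+a with m≤n⇒m<n∨m≡n c≤1+a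
... | inj₁ c<1+a = inj₁ (≤-antisym (≤-pred c<1+a) a≤c)
... | inj₂ c≡1+a = inj₂ c≡1+a

lowerCovers-adjacent : ∀ {μ ν ρ} → Strict μ → ν ∈ lowerCovers μ → Positive ρ →
                       ν ⊑ ρ → ρ ⊑ μ → ρ ≡ ν ⊎ ρ ≡ μ
lowerCovers-adjacent {suc zero ∷ []} {ρ = []} _ (here refl) _ _ _ = inj₁ refl
lowerCovers-adjacent {suc zero ∷ []} {ρ = c ∷ ρ′} _ (here refl) (1≤c ∷ _) _ (c≤1 , ρ′⊑[])
  rewrite ⊑-[] ρ′⊑[] = inj₂ (cong (_∷ []) (≤-antisym c≤1 1≤c))
lowerCovers-adjacent {suc (suc a) ∷ []} {ρ = c ∷ ρ′} _ (here refl) _ (1+a≤c , _) (c≤2+a , ρ′⊑[])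
  rewrite ⊑-[] ρ′⊑[] with a≤c≤1+a⇒c≡a⊎c≡1+a 1+a≤c c≤2+a
... | inj₁ refl = inj₁ refl
... | inj₂ refl = inj₂ refl
lowerCovers-adjacent {a ∷ b ∷ l} {ν} {ρ} (cons _ sμ) ν∈ pρ ν⊑ρ ρ⊑μ
  with ∈-++⁻ (headCover a b l) ν∈
... | inj₁ ν∈head with ∈-headCover⁻ {a} ν∈head
...   | _ , refl with a | ρ | ν⊑ρ | ρ⊑μ
...     | suc a′ | c ∷ ρ′ | a′≤c , bl⊑ρ′ | c≤a , ρ′⊑bl
          with ⊑-antisym ρ′⊑bl bl⊑ρ′ | a≤c≤1+a⇒c≡a⊎c≡1+a a′≤c c≤a
...       | refl | inj₁ refl = inj₁ refl
...       | refl | inj₂ refl = inj₂ refl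
lowerCovers-adjacent {a ∷ b ∷ l} {ν} {ρ} (cons _ sμ) ν∈ pρ ν⊑ρ ρ⊑μ | inj₂ ν∈tail
  with ∈-map⁻ (a ∷_) ν∈tail
... | ν′ , ν′∈ , refl with ρ | pρ | ν⊑ρ | ρ⊑μ
...   | c ∷ ρ′ | _ ∷ pρ′ | a≤c , ν′⊑ρ′ | c≤a , ρ′⊑
        with ≤-antisym c≤a a≤c | lowerCovers-adjacent sμ ν′∈ pρ′ ν′⊑ρ′ ρ′⊑
...     | refl | inj₁ refl = inj₁ refl
...     | refl | inj₂ refl = inj₂ refl

below⇒⊑lowerCover : ∀ {μ ν} → Strict μ → Strict ν → ν ⊑ μ → ν ≢ μ →
                    ∃ λ ρ → ρ ∈ lowerCovers μ × ν ⊑ ρ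
below⇒⊑lowerCover {[]} {[]} _ _ _ ν≢μ = contradiction refl ν≢μ
below⇒⊑lowerCover {a ∷ []} {[]} _ _ _ _ = shrinkLast a , here refl , tt
below⇒⊑lowerCover {zero ∷ []} {_ ∷ []} (one ()) _ _ _
below⇒⊑lowerCover {suc zero ∷ []} {c ∷ []} _ sν (c≤1 , _) ν≢μ =
  contradiction (cong (_∷ []) (≤-antisym c≤1 (strict-head-pos sν))) ν≢μ
below⇒⊑lowerCover {suc (suc a) ∷ []} {c ∷ []} _ _ (c≤2+a , _) ν≢μ with m≤n⇒m<n∨m≡n c≤2+a
... | inj₁ c<2+a = suc a ∷ [] , here refl , (≤-pred c<2+a , tt)
... | inj₂ refl  = contradiction refl ν≢μ
below⇒⊑lowerCover {a ∷ b ∷ l} {[]} (cons _ sμ) _ _ _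
  with below⇒⊑lowerCover sμ nil tt (λ ())
... | ρ′ , ρ′∈ , _ = a ∷ ρ′ , ∈-lowerCovers-cons⁺ ρ′∈ , tt
below⇒⊑lowerCover {a ∷ b ∷ l} {c ∷ ν′} (cons b<a sμ) sν (c≤a , ν′⊑) ν≢μ
  with ≡-dec _≟_ ν′ (b ∷ l)
... | no ν′≢ with below⇒⊑lowerCover sμ (strict-tail sν) ν′⊑ ν′≢
...   | ρ′ , ρ′∈ , ν′⊑ρ′ = a ∷ ρ′ , ∈-lowerCovers-cons⁺ ρ′∈ , (c≤a , ν′⊑ρ′)
below⇒⊑lowerCover {a ∷ b ∷ l} {c ∷ ν′} (cons b<a sμ) (cons b<c _) (c≤a , _) ν≢μ | yes refl
  with m≤n⇒m<n∨m≡n c≤a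
... | inj₂ refl = contradiction refl ν≢μ
... | inj₁ c<a  =
  pred a ∷ b ∷ l , ∈-++⁺ˡ (∈-headCover⁺ l (≤-trans (s≤s b<c) c<a)) , (pred-mono-≤ c<a , ⊑-refl (b ∷ l))

lowerCovers-unique : ∀ {μ} → Strict μ → Unique (lowerCovers μ)
lowerCovers-unique {[]}        _            = []
lowerCovers-unique {a ∷ []}    _            = [] ∷ []
lowerCovers-unique {suc a ∷ b ∷ l} (cons b<a sμ) with hasGap (suc a) b
... | false = Unique.map⁺ ∷-injectiveʳ (lowerCovers-unique sμ)
... | true  = All.tabulate head∉tail ∷ Unique.map⁺ ∷-injectiveʳ (lowerCovers-unique sμ)
  where
  head∉tail : ∀ {ρ} → ρ ∈ map (suc a ∷_) (lowerCovers (b ∷ l)) → a ∷ b ∷ l ≢ ρ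
  head∉tail ρ∈ eq with ∈-map⁻ (suc a ∷_) ρ∈
  ... | _ , _ , refl = 1+n≢n (sym (∷-injectiveˡ eq))

lowerCovers-enumerates : ∀ {μ} → Strict μ → Enumerates (lowerCovers μ) (_⋖ μ)
lowerCovers-enumerates {μ} sμ = lowerCovers-unique sμ , λ ν → mk⇔ (covered ν) (listed ν)
  where
  pμ : Positive μ
  pμ = strict⇒positive sμ

  covered : ∀ ν → ν ∈ lowerCovers μ → ν ⋖ μ
  covered ν ν∈ with lowerCovers-below sμ ν∈
  ... | sν , ν⊑μ , ν≢μ = sν , ⊑∧≢⇒⊂D pμ ν⊑μ ν≢μ , no-between
    where
    no-between : ¬ (Σ (List ℕ) λ ρ → Strict ρ × ν ⊂D ρ × ρ ⊂D μ)
    no-between (ρ , sρ , ν⊂ρ , ρ⊂μ)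
      with ⊂D⇒⊑∧≢ (strict⇒positive sν) ν⊂ρ | ⊂D⇒⊑∧≢ (strict⇒positive sρ) ρ⊂μ
    ... | ν⊑ρ , ν≢ρ | ρ⊑μ , ρ≢μ with lowerCovers-adjacent sμ ν∈ (strict⇒positive sρ) ν⊑ρ ρ⊑μ
    ...   | inj₁ refl = ν≢ρ refl
    ...   | inj₂ refl = ρ≢μ refl

  listed : ∀ ν → ν ⋖ μ → ν ∈ lowerCovers μ
  listed ν (sν , ν⊂μ , no-between) with ⊂D⇒⊑∧≢ (strict⇒positive sν) ν⊂μ
  ... | ν⊑μ , ν≢μ with below⇒⊑lowerCover sμ sν ν⊑μ ν≢μ
  ...   | ρ , ρ∈ , ν⊑ρ with lowerCovers-below sμ ρ∈ | ≡-dec _≟_ ν ρ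
  ...     | _ | yes refl = ρ∈
  ...     | sρ , ρ⊑μ , ρ≢μ | no ν≢ρ =
    contradiction (ρ , sρ , ⊑∧≢⇒⊂D (strict⇒positive sρ) ν⊑ρ ν≢ρ , ⊑∧≢⇒⊂D pμ ρ⊑μ ρ≢μ) no-between

enumerations-↭ : ∀ {P : List ℕ → Set} {xs ys} → Enumerates xs P → Enumerates ys P → xs ↭ ys
enumerations-↭ (!xs , ∈xs⇔P) (!ys , ∈ys⇔P) = ∼bag⇒↭ (unique∧set⇒bag !xs !ys λ {μ} →
  mk⇔ (λ μ∈xs → Equivalence.from (∈ys⇔P μ) (Equivalence.to (∈xs⇔P μ) μ∈xs))
      (λ μ∈ys → Equivalence.from (∈xs⇔P μ) (Equivalence.to (∈ys⇔P μ) μ∈ys)))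

DDeg-functional : ∀ {μ k k′} → DDeg μ k → DDeg μ k′ → k ≡ k′
DDeg-functional (L , enumL , refl) (L′ , enumL′ , refl) = ↭-length (enumerations-↭ enumL enumL′)

fromBool : Bool → ℕ
fromBool false = 0
fromBool true  = 1

corners : List ℕ → ℕ
corners []          = 0
corners (a ∷ [])    = 1
corners (a ∷ b ∷ l) = fromBool (hasGap a b) + corners (b ∷ l)

length-headCover : ∀ a b l → length (headCover a b l) ≡ fromBool (hasGap a b)
length-headCover a b l with hasGap a b
... | false = refl
... | true  = refl

length-lowerCovers : ∀ μ → length (lowerCovers μ) ≡ corners μ
length-lowerCovers []          = refl
length-lowerCovers (a ∷ [])    = refl
length-lowerCovers (a ∷ b ∷ l) = begin
    length (headCover a b l ++ map (a ∷_) (lowerCovers (b ∷ l)))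
  ≡⟨ length-++ (headCover a b l) ⟩
    length (headCover a b l) + length (map (a ∷_) (lowerCovers (b ∷ l)))
  ≡⟨ cong₂ _+_ (length-headCover a b l)
               (trans (length-map (a ∷_) (lowerCovers (b ∷ l))) (length-lowerCovers (b ∷ l))) ⟩
    fromBool (hasGap a b) + corners (b ∷ l)
  ∎
  where open ≡-Reasoning

DDeg-corners : ∀ {μ} → Strict μ → DDeg μ (corners μ)
DDeg-corners {μ} sμ = lowerCovers μ , lowerCovers-enumerates sμ , length-lowerCovers μ

-- Appending the part 1 to grow ν creates a new corner exactly when this is 1.
lastAbove1 : List ℕ → ℕ
lastAbove1 []          = 1
lastAbove1 (a ∷ [])    = fromBool (2 ≤ᵇ a)
lastAbove1 (a ∷ b ∷ l) = lastAbove1 (b ∷ l)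

corners-grow : ∀ ν → corners (grow ν) ≡ corners ν
corners-grow []          = refl
corners-grow (a ∷ [])    = refl
corners-grow (a ∷ b ∷ l) = cong (fromBool (hasGap a b) +_) (corners-grow (b ∷ l))

corners-grow∷ʳ1 : ∀ ν → corners (grow∷ʳ1 ν) ≡ corners ν + lastAbove1 ν
corners-grow∷ʳ1 []          = refl
corners-grow∷ʳ1 (a ∷ [])    = +-comm (fromBool (2 ≤ᵇ a)) 1
corners-grow∷ʳ1 (a ∷ b ∷ l) =
  trans (cong (fromBool (hasGap a b) +_) (corners-grow∷ʳ1 (b ∷ l)))
        (sym (+-assoc (fromBool (hasGap a b)) (corners (b ∷ l)) (lastAbove1 (b ∷ l))))

lastAbove1-grow : ∀ {ν} → Positive ν → lastAbove1 (grow ν) ≡ 1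
lastAbove1-grow {[]}          _          = refl
lastAbove1-grow {suc a ∷ []}  _          = refl
lastAbove1-grow {a ∷ b ∷ l}   (_ ∷ pbl)  = lastAbove1-grow pbl

lastAbove1-grow∷ʳ1 : ∀ ν → lastAbove1 (grow∷ʳ1 ν) ≡ 0
lastAbove1-grow∷ʳ1 []          = refl
lastAbove1-grow∷ʳ1 (a ∷ [])    = refl
lastAbove1-grow∷ʳ1 (a ∷ b ∷ l) = lastAbove1-grow∷ʳ1 (b ∷ l)

sum-map-const : ∀ {A : Set} {f : A → ℕ} {k} xs → All (λ x → f x ≡ k) xs → sum (map f xs) ≡ length xs * k
sum-map-const []       []           = refl
sum-map-const (x ∷ xs) (fx≡k ∷ fxs) = cong₂ _+_ fx≡k (sum-map-const xs fxs)

sum-map-+ : ∀ {A : Set} (f g : A → ℕ) xs → sum (map (λ x → f x + g x) xs) ≡ sum (map f xs) + sum (map g xs)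
sum-map-+ f g []       = refl
sum-map-+ f g (x ∷ xs) = trans (cong (f x + g x +_) (sum-map-+ f g xs)) (interchange (f x) (g x) _ _)
  where
  interchange : ∀ a b c d → a + b + (c + d) ≡ a + c + (b + d)
  interchange = solve-∀

2[1+n]≤1+N⇒2n<N : ∀ {N n} → 2 * suc n ≤ suc N → 2 * n < N
2[1+n]≤1+N⇒2n<N {N} {n} h = ≤-pred (subst (_≤ suc N) (*-suc 2 n) h)

2[1+n]≤2+N⇒2n≤N : ∀ {N n} → 2 * suc n ≤ suc (suc N) → 2 * n ≤ N
2[1+n]≤2+N⇒2n≤N h = ≤-pred (2[1+n]≤1+N⇒2n<N h)

inner⊎boundary : ∀ {N n} → 2 * suc n ≤ suc (suc N) → 2 * suc n ≤ suc N ⊎ N ≡ n + n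
inner⊎boundary {N} {n} h with 2 * suc n ≤? suc N
... | yes inner = inj₁ inner
... | no ¬inner = inj₂ (trans (≤-antisym N≤2n (2[1+n]≤2+N⇒2n≤N h)) (cong (n +_) (+-identityʳ n)))
  where
  N≤2n : N ≤ 2 * n
  N≤2n = ≤-pred (≤-pred (subst (suc N <_) (*-suc 2 n) (≰⇒> ¬inner)))

strictSubs-boundary : ∀ n → strictSubs (n + n) (suc n) ≡ strictSubs (n + n) n
strictSubs-boundary n = strictSubs-collapse (n + n) n (≤-reflexive (cong (n +_) (sym (+-identityʳ n))))

length-strictSubs-step : ∀ N n → 2 * n ≤ N →
  length (strictSubs (suc N) (suc n)) ≡ length (strictSubs N (suc n)) + length (strictSubs N n)
length-strictSubs-step N n 2n≤N rewrite strictSubs-step N n 2n≤N =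
  trans (length-++ (map grow (strictSubs N (suc n))))
        (cong₂ _+_ (length-map grow (strictSubs N (suc n))) (length-map grow∷ʳ1 (strictSubs N n)))

sum-map-strictSubs-step : ∀ (f : List ℕ → ℕ) N n → 2 * n ≤ N →
  sum (map f (strictSubs (suc N) (suc n))) ≡
  sum (map (λ ν → f (grow ν)) (strictSubs N (suc n))) + sum (map (λ ν → f (grow∷ʳ1 ν)) (strictSubs N n))
sum-map-strictSubs-step f N n 2n≤N rewrite strictSubs-step N n 2n≤N = begin
    sum (map f (map grow A ++ map grow∷ʳ1 B))
  ≡⟨ cong sum (map-++ f (map grow A) (map grow∷ʳ1 B)) ⟩
    sum (map f (map grow A) ++ map f (map grow∷ʳ1 B))
  ≡⟨ sum-++ (map f (map grow A)) (map f (map grow∷ʳ1 B)) ⟩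
    sum (map f (map grow A)) + sum (map f (map grow∷ʳ1 B))
  ≡⟨ cong₂ (λ x y → sum x + sum y) (sym (map-∘ A)) (sym (map-∘ B)) ⟩
    sum (map (λ ν → f (grow ν)) A) + sum (map (λ ν → f (grow∷ʳ1 ν)) B)
  ∎
  where
  open ≡-Reasoning
  A B : List (List ℕ)
  A = strictSubs N (suc n)
  B = strictSubs N n

length-strictSubs : ∀ N n → 2 * n ≤ suc N → length (strictSubs N n) ≡ suc N C n
length-strictSubs zero    zero    _ = refl
length-strictSubs zero    (suc n) h = contradiction (2[1+n]≤1+N⇒2n<N h) n≮0
length-strictSubs (suc N) zero    _ = refl
length-strictSubs (suc N) (suc n) h with inner⊎boundary h
... | inj₁ inner = begin
    length (strictSubs (suc N) (suc n))
  ≡⟨ length-strictSubs-step N n (2[1+n]≤2+N⇒2n≤N h) ⟩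
    length (strictSubs N (suc n)) + length (strictSubs N n)
  ≡⟨ cong₂ _+_ (length-strictSubs N (suc n) inner)
               (length-strictSubs N n (≤-trans (2[1+n]≤2+N⇒2n≤N h) (n≤1+n N))) ⟩
    suc N C suc n + suc N C n
  ≡⟨ +-comm (suc N C suc n) (suc N C n) ⟩
    suc N C n + suc N C suc n
  ≡⟨ nCk+nC[k+1]≡[n+1]C[k+1] (suc N) n ⟩
    suc (suc N) C suc n
  ∎
  where open ≡-Reasoning
... | inj₂ refl = begin
    length (strictSubs (suc (n + n)) (suc n))
  ≡⟨ length-strictSubs-step (n + n) n (2[1+n]≤2+N⇒2n≤N h) ⟩
    length (strictSubs (n + n) (suc n)) + length (strictSubs (n + n) n)
  ≡⟨ cong (λ E → length E + length (strictSubs (n + n) n)) (strictSubs-boundary n) ⟩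
    length (strictSubs (n + n) n) + length (strictSubs (n + n) n)
  ≡⟨ cong (λ k → k + k) (length-strictSubs (n + n) n (≤-trans (2[1+n]≤2+N⇒2n≤N h) (n≤1+n _))) ⟩
    suc (n + n) C n + suc (n + n) C n
  ≡⟨ cong (suc (n + n) C n +_) (C-middle n) ⟩
    suc (n + n) C n + suc (n + n) C suc n
  ≡⟨ nCk+nC[k+1]≡[n+1]C[k+1] (suc (n + n)) n ⟩
    suc (suc (n + n)) C suc n
  ∎
  where open ≡-Reasoning

sum-lastAbove1 : ∀ N n → 2 * n ≤ N → sum (map lastAbove1 (strictSubs N n)) ≡ N C n
sum-lastAbove1 zero    zero    _ = refl
sum-lastAbove1 zero    (suc n) h = contradiction h (<⇒≱ (s≤s z≤n))
sum-lastAbove1 (suc N) zero    _ = refl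
sum-lastAbove1 (suc N) (suc n) h = begin
    sum (map lastAbove1 (strictSubs (suc N) (suc n)))
  ≡⟨ sum-map-strictSubs-step lastAbove1 N n (<⇒≤ (2[1+n]≤1+N⇒2n<N h)) ⟩
    sum (map (λ ν → lastAbove1 (grow ν)) A) + sum (map (λ ν → lastAbove1 (grow∷ʳ1 ν)) B)
  ≡⟨ cong₂ _+_ (sum-map-const A (All.tabulate λ {ν} ν∈ → lastAbove1-grow (positive ν ν∈)))
               (sum-map-const B (All.tabulate λ {ν} _ → lastAbove1-grow∷ʳ1 ν)) ⟩
    length A * 1 + length B * 0
  ≡⟨ cong₂ _+_ (*-identityʳ (length A)) (*-zeroʳ (length B)) ⟩
    length A + 0
  ≡⟨ +-identityʳ (length A) ⟩
    length A
  ≡⟨ length-strictSubs N (suc n) h ⟩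
    suc N C suc n
  ∎
  where
  open ≡-Reasoning
  A B : List (List ℕ)
  A = strictSubs N (suc n)
  B = strictSubs N n
  positive : ∀ ν → ν ∈ A → Positive ν
  positive ν ν∈ = strict⇒positive (proj₁ (strictSubs-sound N (suc n) ν ν∈))

sum-corners-step : ∀ N n → 2 * n ≤ N →
  sum (map corners (strictSubs (suc N) (suc n))) ≡
  sum (map corners (strictSubs N (suc n))) + (sum (map corners (strictSubs N n)) + N C n)
sum-corners-step N n 2n≤N = begin
    sum (map corners (strictSubs (suc N) (suc n)))
  ≡⟨ sum-map-strictSubs-step corners N n 2n≤N ⟩
    sum (map (λ ν → corners (grow ν)) A) + sum (map (λ ν → corners (grow∷ʳ1 ν)) B)
  ≡⟨ cong₂ (λ x y → sum x + sum y) (map-cong corners-grow A) (map-cong corners-grow∷ʳ1 B) ⟩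
    sum (map corners A) + sum (map (λ ν → corners ν + lastAbove1 ν) B)
  ≡⟨ cong (sum (map corners A) +_) (sum-map-+ corners lastAbove1 B) ⟩
    sum (map corners A) + (sum (map corners B) + sum (map lastAbove1 B))
  ≡⟨ cong (λ x → sum (map corners A) + (sum (map corners B) + x)) (sum-lastAbove1 N n 2n≤N) ⟩
    sum (map corners A) + (sum (map corners B) + N C n)
  ∎
  where
  open ≡-Reasoning
  A B : List (List ℕ)
  A = strictSubs N (suc n)
  B = strictSubs N n

sum-corners : ∀ N n → 2 * n ≤ suc N → sum (map corners (strictSubs N n)) ≡ n * (N C n)
sum-corners zero    zero    _ = refl
sum-corners zero    (suc n) h = contradiction (2[1+n]≤1+N⇒2n<N h) n≮0
sum-corners (suc N) zero    _ = refl
sum-corners (suc N) (suc n) h with inner⊎boundary h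
... | inj₁ inner = begin
    sum (map corners (strictSubs (suc N) (suc n)))
  ≡⟨ sum-corners-step N n (2[1+n]≤2+N⇒2n≤N h) ⟩
    sum (map corners (strictSubs N (suc n))) + (sum (map corners (strictSubs N n)) + N C n)
  ≡⟨ cong₂ (λ x y → x + (y + N C n)) (sum-corners N (suc n) inner)
                                      (sum-corners N n (≤-trans (2[1+n]≤2+N⇒2n≤N h) (n≤1+n N))) ⟩
    suc n * (N C suc n) + (n * (N C n) + N C n)
  ≡⟨ regroup n (N C n) (N C suc n) ⟩
    suc n * (N C n + N C suc n)
  ≡⟨ cong (suc n *_) (nCk+nC[k+1]≡[n+1]C[k+1] N n) ⟩
    suc n * (suc N C suc n)
  ∎
  where
  open ≡-Reasoning
  regroup : ∀ n a b → suc n * b + (n * a + a) ≡ suc n * (a + b)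
  regroup = solve-∀
... | inj₂ refl = begin
    sum (map corners (strictSubs (suc (n + n)) (suc n)))
  ≡⟨ sum-corners-step (n + n) n (2[1+n]≤2+N⇒2n≤N h) ⟩
    sum (map corners (strictSubs (n + n) (suc n))) + (sum (map corners (strictSubs (n + n) n)) + A)
  ≡⟨ cong (λ E → sum (map corners E) + (sum (map corners (strictSubs (n + n) n)) + A))
          (strictSubs-boundary n) ⟩
    sum (map corners (strictSubs (n + n) n)) + (sum (map corners (strictSubs (n + n) n)) + A)
  ≡⟨ cong (λ x → x + (x + A)) (sum-corners (n + n) n (≤-trans (2[1+n]≤2+N⇒2n≤N h) (n≤1+n _))) ⟩
    n * A + (n * A + A)
  ≡⟨ regroup n A ⟩
    suc (n + n) * A
  ≡⟨ sym ([1+k]*[1+n]C[1+k]≡[1+n]*nCk (n + n) n) ⟩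
    suc n * (suc (n + n) C suc n)
  ∎
  where
  open ≡-Reasoning
  A : ℕ
  A = (n + n) C n
  regroup : ∀ n a → n * a + (n * a + a) ≡ suc (n + n) * a
  regroup = solve-∀

size-lam : ∀ N n → 2 * n ≤ suc N → size (lam N n) + n * n ≡ n * suc N
size-lam N zero    _ = refl
size-lam N (suc n) h = begin
    sum (lam N (suc n)) + suc n * suc n
  ≡⟨ cong (λ xs → sum xs + suc n * suc n) (trans (lam-stair N (suc n)) (sym (applyUpTo-∷ʳ f n))) ⟩
    sum (applyUpTo f n ∷ʳ f n) + suc n * suc n
  ≡⟨ cong (_+ suc n * suc n) (sum-++ (applyUpTo f n) (f n ∷ [])) ⟩
    sum (applyUpTo f n) + (f n + 0) + suc n * suc n
  ≡⟨ regroup (sum (applyUpTo f n)) (f n) n ⟩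
    (sum (applyUpTo f n) + n * n) + suc (f n + 2 * n)
  ≡⟨ cong₂ (λ s x → s + suc x) (trans (cong (λ xs → sum xs + n * n) (sym (lam-stair N n)))
                                      (size-lam N n (≤-trans 2n≤N (n≤1+n N))))
                               (m∸n+n≡m 2n≤N) ⟩
    n * suc N + suc N
  ≡⟨ +-comm (n * suc N) (suc N) ⟩
    suc n * suc N
  ∎
  where
  open ≡-Reasoning
  f : ℕ → ℕ
  f = stair N 0
  2n≤N : 2 * n ≤ N
  2n≤N = <⇒≤ (2[1+n]≤1+N⇒2n<N h)
  regroup : ∀ s x n → s + (x + 0) + suc n * suc n ≡ (s + n * n) + suc (x + 2 * n)
  regroup = solve-∀

-- Adding n² C(N+1, n) = n (N + 1) C(N, n − 1) to both sides makes each equal to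
-- n (N + 1) C(N+1, n), by |λ| + n² = n (N + 1) and Pascal's rule.
R-closed-form : ∀ N n → 2 * n ≤ suc N → suc N * (n * (N C n)) ≡ size (lam N n) * (suc N C n)
R-closed-form N zero    _ = *-zeroʳ (suc N)
R-closed-form N (suc k) h = sym (+-cancelʳ-≡ (n * (suc N * A)) (s * Cn) (suc N * (n * B)) both)
  where
  open ≡-Reasoning
  n s A B Cn : ℕ
  n = suc k
  s = size (lam N n)
  A = N C k
  B = N C n
  Cn = suc N C n
  both : s * Cn + n * (suc N * A) ≡ suc N * (n * B) + n * (suc N * A)
  both = begin
      s * Cn + n * (suc N * A)
    ≡⟨ cong (λ x → s * Cn + n * x) (sym ([1+k]*[1+n]C[1+k]≡[1+n]*nCk N k)) ⟩
      s * Cn + n * (n * Cn)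
    ≡⟨ factor s n Cn ⟩
      (s + n * n) * Cn
    ≡⟨ cong (_* Cn) (size-lam N n h) ⟩
      n * suc N * Cn
    ≡⟨ cong (n * suc N *_) (sym (nCk+nC[k+1]≡[n+1]C[k+1] N k)) ⟩
      n * suc N * (A + B)
    ≡⟨ expand n (suc N) A B ⟩
      suc N * (n * B) + n * (suc N * A)
    ∎
    where
    factor : ∀ s n c → s * c + n * (n * c) ≡ (s + n * n) * c
    factor = solve-∀
    expand : ∀ n m a b → n * m * (a + b) ≡ m * (n * b) + n * (m * a)
    expand = solve-∀

lemma5p3 : (N n : ℕ) → 1 ≤ n → 2 * n ≤ suc N →
    (Σ (List (List ℕ)) λ L → Σ (List ℕ → ℕ) λ d → RData (lam N n) L d)
    × (∀ L d → RData (lam N n) L d →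
         suc N * sum (map d L) ≡ size (lam N n) * (suc N C n))
lemma5p3 N n _ 2n≤1+N =
  (strictSubs N n , corners , strictSubs-enumerates N n ,
   λ μ μ∈ → DDeg-corners (proj₁ (strictSubs-sound N n μ μ∈))) ,
  value
  where
  value : ∀ L d → RData (lam N n) L d → suc N * sum (map d L) ≡ size (lam N n) * (suc N C n)
  value L d (enumL , ddegL) = begin
      suc N * sum (map d L)
    ≡⟨ cong (λ xs → suc N * sum xs) (map-cong-local (All.tabulate d≡corners)) ⟩
      suc N * sum (map corners L)
    ≡⟨ cong (suc N *_) (sum-↭ (↭.map⁺ corners (enumerations-↭ enumL (strictSubs-enumerates N n)))) ⟩
      suc N * sum (map corners (strictSubs N n))
    ≡⟨ cong (suc N *_) (sum-corners N n 2n≤1+N) ⟩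
      suc N * (n * (N C n))
    ≡⟨ R-closed-form N n 2n≤1+N ⟩
      size (lam N n) * (suc N C n)
    ∎
    where
    open ≡-Reasoning
    d≡corners : ∀ {μ} → μ ∈ L → d μ ≡ corners μ
    d≡corners {μ} μ∈L =
      DDeg-functional {μ} (ddegL μ μ∈L) (DDeg-corners (proj₁ (Equivalence.to (proj₂ enumL μ) μ∈L)))
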